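{- Let $<$ be a regular $\neg$-decreasing total ordering of $Sen(L)$. Then $Sen(L)$ is the disjoint union of two sets $I$ and $J$ which are both $\sim$-saturated and selective, so that $\alpha\in I\iff\neg\alpha\in J$ for all $\alpha$, and such that $I<J$, i.e. $I$ is an initial segment and $J$ a final segment of $\langle Sen(L),<\rangle$.
   Context: $L$ is the classical propositional language with atoms $p_0,p_1,\ldots$ and connectives $\neg,\wedge$; $\sim$ is classical equivalence on $Sen(L)$, $[\alpha]=\{\beta:\beta\sim\alpha\}$. A total ordering $<$ of $Sen(L)$ is regular if $\alpha\not\sim\beta$ and $\alpha<\beta$ imply $\alpha'<\beta'$ for all $\alpha'\in[\alpha],\beta'\in[\beta]$; it is $\neg$-decreasing if for all $\alpha\not\sim\beta$: $\alpha<\beta\iff\neg\beta<\neg\alpha$. A set $X\subseteq Sen(L)$ is selective if for every $\alpha$ it contains exactly one of $\alpha,\neg\alpha$, and $\sim$-saturated if $\alpha\in X$ implies $[\alpha]\subseteq X$. -}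

module Defs where

open import Level using (Level)
open import Data.Nat using (ℕ)
open import Data.Bool using (Bool; not; _∧_)
open import Data.Product using (_×_)
open import Data.Sum using (_⊎_)
open import Relation.Nullary using (¬_)
open import Relation.Unary using (Pred)
open import Relation.Binary using (Rel)
open import Relation.Binary.PropositionalEquality using (_≡_)

data Sen : Set where
  atom : ℕ → Sen
  neg  : Sen → Sen
  conj : Sen → Sen → Sen

eval : (ℕ → Bool) → Sen → Bool
eval v (atom n)   = v n
eval v (neg a)    = not (eval v a)
eval v (conj a b) = eval v a ∧ eval v b

_∼_ : Sen → Sen → Set
α ∼ β = ∀ (v : ℕ → Bool) → eval v α ≡ eval v β

infix 4 _∼_

module _ {ℓ : Level} (_<_ : Rel Sen ℓ) where

  Regular : Set ℓ
  Regular = ∀ α β α' β' → ¬ (α ∼ β) → α < β → α ∼ α' → β ∼ β' → α' < β'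

  NegDecreasing : Set ℓ
  NegDecreasing = ∀ α β → ¬ (α ∼ β) → (α < β → neg β < neg α) × (neg β < neg α → α < β)

module _ {ℓ : Level} where

  Selective : Pred Sen ℓ → Set ℓ
  Selective X = ∀ α → (X α ⊎ X (neg α)) × ¬ (X α × X (neg α))

  Saturated : Pred Sen ℓ → Set ℓ
  Saturated X = ∀ α β → X α → α ∼ β → X β

{-# OPTIONS --safe #-}
-- I is the set of sentences lying below their negation and J the set of those above it.
-- Regularity makes both sets ∼-saturated and swaps them under negation (as ¬¬α ∼ α),
-- which gives selectivity. If some α ∈ I lay above some β ∈ J, then ¬-decreasingness
-- would close the cycle ¬α < ¬β < β < α < ¬α.
module Submission where

open import Defs
open import Level using (Level)
open import Data.Bool using (true; not)
open import Data.Bool.Properties using (not-¬; not-involutive)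
open import Data.Product using (_×_; Σ; _,_; proj₁) renaming (swap to ×-swap)
open import Data.Sum using (_⊎_; inj₁; inj₂; swap; map₂)
open import Function using (_∘_)
open import Relation.Nullary using (¬_; contradiction)
open import Relation.Unary using (Pred)
open import Relation.Binary using (Rel; IsStrictTotalOrder; tri<; tri≈; tri>)
open import Relation.Binary.PropositionalEquality using (_≡_; refl; sym; cong)

∼-refl : ∀ α → α ∼ α
∼-refl α v = refl

∼-sym : ∀ α β → α ∼ β → β ∼ α
∼-sym α β α∼β v = sym (α∼β v)

neg-cong : ∀ α β → α ∼ β → neg α ∼ neg β
neg-cong α β α∼β v = cong not (α∼β v)

∼-neg-neg : ∀ α → α ∼ neg (neg α)
∼-neg-neg α v = sym (not-involutive (eval v α))

≁-neg : ∀ α → ¬ (α ∼ neg α)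
≁-neg α α∼¬α = not-¬ refl (α∼¬α (λ _ → true))

neg-≁ : ∀ α → ¬ (neg α ∼ α)
neg-≁ α = ≁-neg α ∘ ∼-sym (neg α) α

selective-of-partition : ∀ {ℓ} {X Y : Pred Sen ℓ} →
  (∀ α → X α ⊎ Y α) → (∀ α → ¬ (X α × Y α)) →
  (∀ α → Y α → X (neg α)) → (∀ α → X (neg α) → Y α) → Selective X
selective-of-partition cover disjoint Y⇒X-neg X-neg⇒Y α =
  map₂ (Y⇒X-neg α) (cover α) , λ { (x , x-neg) → disjoint α (x , X-neg⇒Y α x-neg) }

module NegationSplit {ℓ} {_<_ : Rel Sen ℓ}
                     (sto : IsStrictTotalOrder _≡_ _<_) (reg : Regular _<_) where

  open IsStrictTotalOrder sto using (compare; irrefl; asym; trans)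

  Lower Upper : Pred Sen ℓ
  Lower α = α < neg α
  Upper α = neg α < α

  lower⊎upper : ∀ α → Lower α ⊎ Upper α
  lower⊎upper α with compare α (neg α)
  ... | tri< lo _ _   = inj₁ lo
  ... | tri≈ _ α≡¬α _ = contradiction (λ v → cong (eval v) α≡¬α) (≁-neg α)
  ... | tri> _ _ up   = inj₂ up

  lower-upper-disjoint : ∀ α → ¬ (Lower α × Upper α)
  lower-upper-disjoint α (lo , up) = asym lo up

  lower-saturated : Saturated Lower
  lower-saturated α β lo α∼β = reg α (neg α) β (neg β) (≁-neg α) lo α∼β (neg-cong α β α∼β)

  upper-saturated : Saturated Upper
  upper-saturated α β up α∼β = reg (neg α) α (neg β) β (neg-≁ α) up (neg-cong α β α∼β) α∼β

  lower⇒upper-neg : ∀ α → Lower α → Upper (neg α)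
  lower⇒upper-neg α lo =
    reg α (neg α) (neg (neg α)) (neg α) (≁-neg α) lo (∼-neg-neg α) (∼-refl (neg α))

  upper-neg⇒lower : ∀ α → Upper (neg α) → Lower α
  upper-neg⇒lower α up =
    reg (neg (neg α)) (neg α) α (neg α) (neg-≁ (neg α)) up (∼-sym α (neg (neg α)) (∼-neg-neg α)) (∼-refl (neg α))

  upper⇒lower-neg : ∀ α → Upper α → Lower (neg α)
  upper⇒lower-neg α up =
    reg (neg α) α (neg α) (neg (neg α)) (neg-≁ α) up (∼-refl (neg α)) (∼-neg-neg α)

  lower-neg⇒upper : ∀ α → Lower (neg α) → Upper α
  lower-neg⇒upper α lo =
    reg (neg α) (neg (neg α)) (neg α) α (≁-neg (neg α)) lo (∼-refl (neg α)) (∼-sym α (neg (neg α)) (∼-neg-neg α))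

  lower-selective : Selective Lower
  lower-selective =
    selective-of-partition lower⊎upper lower-upper-disjoint upper⇒lower-neg lower-neg⇒upper

  upper-selective : Selective Upper
  upper-selective =
    selective-of-partition (swap ∘ lower⊎upper) (λ α → lower-upper-disjoint α ∘ ×-swap)
                           lower⇒upper-neg upper-neg⇒lower

  lower<upper : NegDecreasing _<_ → ∀ α β → Lower α → Upper β → α < β
  lower<upper nd α β lo up with compare α β
  ... | tri< α<β _ _ = α<β
  ... | tri≈ _ refl _ = contradiction (lo , up) (lower-upper-disjoint α)
  ... | tri> _ _ β<α = contradiction (trans ¬α<¬β (trans up (trans β<α lo))) (irrefl refl)
    where
    β≁α : ¬ (β ∼ α)
    β≁α β∼α = lower-upper-disjoint β (lower-saturated α β lo (∼-sym β α β∼α) , up)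

    ¬α<¬β : neg α < neg β
    ¬α<¬β = proj₁ (nd β α β≁α) β<α

proposition2p44 : {ℓ : Level} (_<_ : Rel Sen ℓ) → IsStrictTotalOrder _≡_ _<_ →
    Regular _<_ → NegDecreasing _<_ →
    Σ (Pred Sen ℓ) λ I → Σ (Pred Sen ℓ) λ J →
      (∀ α → I α ⊎ J α) × (∀ α → ¬ (I α × J α)) ×
      Saturated I × Saturated J × Selective I × Selective J ×
      (∀ α → (I α → J (neg α)) × (J (neg α) → I α)) ×
      (∀ α β → I α → J β → α < β)
proposition2p44 _<_ sto reg nd =
  Lower , Upper , lower⊎upper , lower-upper-disjoint ,
  lower-saturated , upper-saturated , lower-selective , upper-selective ,
  (λ α → lower⇒upper-neg α , upper-neg⇒lower α) , lower<upper nd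
  where open NegationSplit sto reg
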